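{- Let $t$ be a positive integer, $L\ge2$ an integer, and $(a_1,b_1),\dots,(a_t,b_t)$ couples of integers with $1\le a_i,b_i\le L$ for all $i$. Let $A$ be a set of nonnegative integers and $m$ a positive integer. Define $\Gamma_0(A)=A$ and $\Gamma_k(A)=a_k\Gamma_{k-1}(A)-b_k\Gamma_{k-1}(A)$ for $1\le k\le t$. If $t\ge 2\log_2(m)+4L+2$, then there exist positive integers $\alpha\le L^t$ and $\beta\le L^t$ and a set of integers $B$ such that $$\Gamma_t(A)=\alpha Am-\beta Am+B.$$
   Context: For $X\subset\mathbb{Z}$: $nX=\{nx\mid x\in X\}$ (dilation), $Xm=X+\cdots+X$ ($m$-fold sumset), and $\alpha Xm=\alpha(Xm)=\{\alpha y\mid y\in X+\cdots+X\}$. Thus $\alpha Am-\beta Am+B=\{y-y'+z\mid y\in\alpha Am,\ y'\in\beta Am,\ z\in B\}$. Also $aX-bX=\{ax-bx'\mid x,x'\in X\}$. -}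

module Defs where

open import Level using (0ℓ)
open import Data.Nat using (ℕ; zero; suc)
open import Data.Integer using (ℤ; +_; _+_; _-_; _*_)
open import Data.Product using (∃; ∃₂; _×_)
open import Relation.Unary using (Pred)
open import Relation.Binary.PropositionalEquality using (_≡_)

ZSet : Set₁
ZSet = Pred ℤ 0ℓ

dil : ℤ → ZSet → ZSet
dil n X y = ∃ λ x → X x × y ≡ n * x

-- m-fold sumset  Xm = X + ... + X  (m copies); by convention X0 = {0},
-- so that for m ≥ 1 this is exactly the m-fold sumset.
sumset : ℕ → ZSet → ZSet
sumset zero X y = y ≡ + 0
sumset (suc m) X y = ∃₂ λ u v → sumset m X u × X v × y ≡ u + v

dilDiff : ℤ → ℤ → ZSet → ZSet
dilDiff a b X y = ∃₂ λ x x' → X x × X x' × y ≡ a * x - b * x'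

Γ : (ℕ → ℕ) → (ℕ → ℕ) → ZSet → ℕ → ZSet
Γ a b A zero = A
Γ a b A (suc k) = dilDiff (+ a (suc k)) (+ b (suc k)) (Γ a b A k)

diffPlus : ℤ → ℤ → ℕ → ZSet → ZSet → ZSet
diffPlus α β m A B w =
  ∃₂ λ y y' → ∃ λ z → dil α (sumset m A) y × dil β (sumset m A) y' × B z × w ≡ y - y' + z

module Submission where

-- Unfolding the recursion, every element of Γ_t(A) is a linear form
-- c₁x₁ + ⋯ + c_Nx_N (N = 2^t) in elements xᵢ ∈ A whose coefficients are ±(products
-- of t factors a_k or b_k).  Exactly half of the coefficients are positive and half
-- negative, so each sign occurs 2^(t-1) times.  Every coefficient magnitude is a
-- product of t numbers from {1,…,L}, and the number f of such products (counted as
-- multisets of factors) satisfies f² ≤ 2^(t+4L).  The hypothesis on t then gives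
-- m·f ≤ 2^(t-1), so by the pigeonhole principle some positive value α and some
-- negative value -β each occur at least m times.  Gathering these 2m terms shows
-- Γ_t(A) = α(Am) - β(Am) + B, where B collects the remaining terms.

open import Defs

module LinearSets where

  open import Data.Nat as ℕ using (ℕ)
  open import Data.Integer using (ℤ; +_; -_; _+_; _-_; _*_; 0ℤ; 1ℤ)
  open import Data.Integer.Properties
    using (+-identityˡ; +-identityʳ; +-comm; +-assoc; *-identityˡ; *-identityʳ; *-zeroʳ; neg-distribˡ-*; neg-distribʳ-*; pos-*)
  open import Data.Integer.Tactic.RingSolver using (solve-∀)
  open import Data.List using (List; []; _∷_; _++_; map; replicate)
  open import Data.List.Properties using (map-++; map-replicate; map-cong; map-∘; ++-assoc)
  open import Data.List.Relation.Binary.Permutation.Propositional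
    using (_↭_; refl; prep; swap; trans; ↭-sym; module PermutationReasoning)
  import Data.List.Relation.Binary.Permutation.Propositional.Properties as Perm
  open import Data.Product using (∃₂; _×_; _,_)
  open import Relation.Unary using (_≐_; _⊆_)
  open import Relation.Unary.Properties using (≐-refl; ≐-sym; ≐-trans)
  open import Relation.Binary.PropositionalEquality
    using (_≡_; refl; sym; cong; cong₂; subst) renaming (trans to ≡-trans)

  _⊕_ : ZSet → ZSet → ZSet
  (X ⊕ Y) y = ∃₂ λ u v → X u × Y v × y ≡ u + v

  ⊕-cong : ∀ {X X′ Y Y′} → X ≐ X′ → Y ≐ Y′ → (X ⊕ Y) ≐ (X′ ⊕ Y′)
  ⊕-cong (f , g) (f′ , g′) =
    (λ (u , v , hu , hv , e) → u , v , f hu , f′ hv , e) ,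
    (λ (u , v , hu , hv , e) → u , v , g hu , g′ hv , e)

  dil-cong : ∀ c {X Y} → X ≐ Y → dil c X ≐ dil c Y
  dil-cong c (f , g) = (λ (x , h , e) → x , f h , e) , (λ (x , h , e) → x , g h , e)

  dilDiff≐⊕ : ∀ a b X → dilDiff a b X ≐ (dil a X ⊕ dil (- b) X)
  dilDiff≐⊕ a b X = split , join
    where
    split : dilDiff a b X ⊆ (dil a X ⊕ dil (- b) X)
    split (x , x′ , hx , hx′ , refl) =
      a * x , - b * x′ , (x , hx , refl) , (x′ , hx′ , refl) ,
      cong (λ z → a * x + z) (neg-distribˡ-* b x′)
    join : (dil a X ⊕ dil (- b) X) ⊆ dilDiff a b X
    join (_ , _ , (x , hx , refl) , (x′ , hx′ , refl) , refl) =
      x , x′ , hx , hx′ , cong (λ z → a * x + z) (sym (neg-distribˡ-* b x′))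

  diffPlus≐⊕ : ∀ α β m A B →
    diffPlus α β m A B ≐ (dil α (sumset m A) ⊕ (dil (- β) (sumset m A) ⊕ B))
  diffPlus≐⊕ α β m A B = split , join
    where
    regroup : ∀ y b s z → y - b * s + z ≡ y + (- b * s + z)
    regroup = solve-∀
    split : diffPlus α β m A B ⊆ (dil α (sumset m A) ⊕ (dil (- β) (sumset m A) ⊕ B))
    split (y , _ , z , hy , (s , hs , refl) , hz , refl) =
      y , - β * s + z , hy , (- β * s , z , (s , hs , refl) , hz , refl) , regroup y β s z
    join : (dil α (sumset m A) ⊕ (dil (- β) (sumset m A) ⊕ B)) ⊆ diffPlus α β m A B
    join (y , _ , hy , (_ , z , (s , hs , refl) , hz , refl) , refl) =
      y , β * s , z , hy , (s , hs , refl) , hz , sym (regroup y β s z)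

  module _ (A : ZSet) where

    LinSet : List ℤ → ZSet
    LinSet [] y = y ≡ 0ℤ
    LinSet (c ∷ cs) y = ∃₂ λ x u → A x × LinSet cs u × y ≡ c * x + u

    LinSet-++ : ∀ xs ys → LinSet (xs ++ ys) ≐ (LinSet xs ⊕ LinSet ys)
    LinSet-++ xs ys = split xs , join xs
      where
      split : ∀ xs → LinSet (xs ++ ys) ⊆ (LinSet xs ⊕ LinSet ys)
      split [] {y} h = 0ℤ , y , refl , h , sym (+-identityˡ y)
      split (c ∷ cs) (x , u , ax , hu , refl) with split cs hu
      ... | u₁ , u₂ , h₁ , h₂ , refl =
        c * x + u₁ , u₂ , (x , u₁ , ax , h₁ , refl) , h₂ , sym (+-assoc (c * x) u₁ u₂)
      join : ∀ xs → (LinSet xs ⊕ LinSet ys) ⊆ LinSet (xs ++ ys)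
      join [] (_ , v , refl , hv , refl) = subst (LinSet ys) (sym (+-identityˡ v)) hv
      join (c ∷ cs) (_ , v , (x , u , ax , hu , refl) , hv , refl) =
        x , u + v , ax , join cs (u , v , hu , hv , refl) , +-assoc (c * x) u v

    LinSet-↭ : ∀ {xs ys} → xs ↭ ys → LinSet xs ≐ LinSet ys
    LinSet-↭ p = permute p , permute (↭-sym p)
      where
      exchange : ∀ p q r → p + (q + r) ≡ q + (p + r)
      exchange = solve-∀
      permute : ∀ {xs ys} → xs ↭ ys → LinSet xs ⊆ LinSet ys
      permute refl h = h
      permute (prep c p) (x , u , ax , hu , e) = x , u , ax , permute p hu , e
      permute (swap c d p) (x , _ , ax , (x′ , u , ax′ , hu , refl) , refl) =
        x′ , c * x + u , ax′ , (x , u , ax , permute p hu , refl) , exchange (c * x) (d * x′) u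
      permute (trans p q) h = permute q (permute p h)

    LinSet-map : ∀ c xs → LinSet (map (c *_) xs) ≐ dil c (LinSet xs)
    LinSet-map c xs = out xs , into xs
      where
      distrib : ∀ c d x s → c * (d * x + s) ≡ c * d * x + c * s
      distrib = solve-∀
      out : ∀ xs → LinSet (map (c *_) xs) ⊆ dil c (LinSet xs)
      out [] refl = 0ℤ , refl , sym (*-zeroʳ c)
      out (d ∷ ds) (x , u , ax , hu , refl) with out ds hu
      ... | s , hs , refl = d * x + s , (x , s , ax , hs , refl) , sym (distrib c d x s)
      into : ∀ xs → dil c (LinSet xs) ⊆ LinSet (map (c *_) xs)
      into [] (_ , refl , refl) = *-zeroʳ c
      into (d ∷ ds) (_ , (x , u , ax , hu , refl) , refl) =
        x , c * u , ax , into ds (u , hu , refl) , distrib c d x u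

    LinSet-ones : ∀ m → LinSet (replicate m 1ℤ) ≐ sumset m A
    LinSet-ones m = out m , into m
      where
      out : ∀ m → LinSet (replicate m 1ℤ) ⊆ sumset m A
      out ℕ.zero refl = refl
      out (ℕ.suc m) (x , u , ax , hu , refl) =
        u , x , out m hu , ax , ≡-trans (cong (_+ u) (*-identityˡ x)) (+-comm x u)
      into : ∀ m → sumset m A ⊆ LinSet (replicate m 1ℤ)
      into ℕ.zero refl = refl
      into (ℕ.suc m) (u , x , hu , ax , refl) =
        x , u , ax , into m hu , ≡-trans (+-comm u x) (cong (_+ u) (sym (*-identityˡ x)))

    LinSet-replicate : ∀ c m → LinSet (replicate m c) ≐ dil c (sumset m A)
    LinSet-replicate c m = ≐-trans (subst (λ cs → LinSet (replicate m c) ≐ LinSet cs) scaled ≐-refl)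
                                   (≐-trans (LinSet-map c (replicate m 1ℤ)) (dil-cong c (LinSet-ones m)))
      where
      scaled : replicate m c ≡ map (c *_) (replicate m 1ℤ)
      scaled = ≡-trans (cong (λ d → replicate m d) (sym (*-identityʳ c))) (sym (map-replicate (c *_) m 1ℤ))

  neg : ℕ → ℤ
  neg n = - (+ n)

  signed : List ℕ → List ℕ → List ℤ
  signed P N = map +_ P ++ map neg N

  signed-scale : ∀ a b P N →
    map (+ a *_) (signed P N) ++ map (neg b *_) (signed P N) ↭
    signed (map (a ℕ.*_) P ++ map (b ℕ.*_) N) (map (a ℕ.*_) N ++ map (b ℕ.*_) P)
  signed-scale a b P N = begin
    map (+ a *_) (map +_ P ++ map neg N) ++ map (neg b *_) (map +_ P ++ map neg N)
      ≡⟨ cong₂ _++_ (≡-trans (map-++ _ (map +_ P) _) (cong₂ _++_ (commute pos-pos P) (commute pos-neg N)))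
                    (≡-trans (map-++ _ (map +_ P) _) (cong₂ _++_ (commute neg-pos P) (commute neg-neg N))) ⟩
    (map +_ aP ++ map neg aN) ++ (map neg bP ++ map +_ bN)
      ↭⟨ interleave (map +_ aP) (map neg aN) (map neg bP) (map +_ bN) ⟩
    (map +_ aP ++ map +_ bN) ++ (map neg aN ++ map neg bP)
      ≡⟨ sym (cong₂ _++_ (map-++ +_ aP bN) (map-++ neg aN bP)) ⟩
    signed (aP ++ bN) (aN ++ bP) ∎
    where
    open PermutationReasoning
    aP aN bP bN : List ℕ
    aP = map (a ℕ.*_) P
    aN = map (a ℕ.*_) N
    bP = map (b ℕ.*_) P
    bN = map (b ℕ.*_) N
    commute : ∀ {f : ℤ → ℤ} {g g′ : ℕ → ℤ} {h : ℕ → ℕ} → (∀ x → f (g x) ≡ g′ (h x)) →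
              ∀ xs → map f (map g xs) ≡ map g′ (map h xs)
    commute e xs = ≡-trans (sym (map-∘ xs)) (≡-trans (map-cong e xs) (map-∘ xs))
    pos-pos : ∀ x → + a * + x ≡ + (a ℕ.* x)
    pos-pos x = sym (pos-* a x)
    pos-neg : ∀ x → + a * neg x ≡ neg (a ℕ.* x)
    pos-neg x = ≡-trans (sym (neg-distribʳ-* (+ a) (+ x))) (cong -_ (pos-pos x))
    neg-pos : ∀ x → neg b * + x ≡ neg (b ℕ.* x)
    neg-pos x = ≡-trans (sym (neg-distribˡ-* (+ b) (+ x))) (cong -_ (sym (pos-* b x)))
    neg-neg : ∀ x → neg b * neg x ≡ + (b ℕ.* x)
    neg-neg x = ≡-trans (neg-mul-neg (+ b) (+ x)) (sym (pos-* b x))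
      where
      neg-mul-neg : ∀ p q → - p * - q ≡ p * q
      neg-mul-neg = solve-∀
    interleave : ∀ {X : Set} (w x y z : List X) → (w ++ x) ++ (y ++ z) ↭ (w ++ z) ++ (x ++ y)
    interleave w x y z = begin
      (w ++ x) ++ (y ++ z) ≡⟨ ++-assoc w x (y ++ z) ⟩
      w ++ (x ++ (y ++ z)) ↭⟨ Perm.++⁺ˡ w (Perm.++-comm x (y ++ z)) ⟩
      w ++ ((y ++ z) ++ x) ≡⟨ cong (w ++_) (++-assoc y z x) ⟩
      w ++ (y ++ (z ++ x)) ↭⟨ Perm.++⁺ˡ w (Perm.shifts y z) ⟩
      w ++ (z ++ (y ++ x)) ↭⟨ Perm.++⁺ˡ w (Perm.++⁺ˡ z (Perm.++-comm y x)) ⟩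
      w ++ (z ++ (x ++ y)) ≡⟨ sym (++-assoc w z (x ++ y)) ⟩
      (w ++ z) ++ (x ++ y) ∎

  -- Coefficients of Γ_k(A) written as a linear form: the positive ones and the
  -- absolute values of the negative ones.
  mutual
    posCoeffs : (ℕ → ℕ) → (ℕ → ℕ) → ℕ → List ℕ
    posCoeffs a b ℕ.zero = 1 ∷ []
    posCoeffs a b (ℕ.suc k) =
      map (a (ℕ.suc k) ℕ.*_) (posCoeffs a b k) ++ map (b (ℕ.suc k) ℕ.*_) (negCoeffs a b k)

    negCoeffs : (ℕ → ℕ) → (ℕ → ℕ) → ℕ → List ℕ
    negCoeffs a b ℕ.zero = []
    negCoeffs a b (ℕ.suc k) =
      map (a (ℕ.suc k) ℕ.*_) (negCoeffs a b k) ++ map (b (ℕ.suc k) ℕ.*_) (posCoeffs a b k)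

  Γ≐LinSet : ∀ a b A k → Γ a b A k ≐ LinSet A (signed (posCoeffs a b k) (negCoeffs a b k))
  Γ≐LinSet a b A ℕ.zero = single , unsingle
    where
    single : A ⊆ LinSet A (+ 1 ∷ [])
    single {y} h = y , 0ℤ , h , refl , sym (≡-trans (+-identityʳ (+ 1 * y)) (*-identityˡ y))
    unsingle : LinSet A (+ 1 ∷ []) ⊆ A
    unsingle (x , _ , ax , refl , refl) = subst A (sym (≡-trans (+-identityʳ (+ 1 * x)) (*-identityˡ x))) ax
  Γ≐LinSet a b A (ℕ.suc k) =
    ≐-trans (dilDiff≐⊕ α (+ b (ℕ.suc k)) (Γ a b A k))
    (≐-trans (⊕-cong (dil-cong α IH) (dil-cong β IH))
    (≐-trans (⊕-cong (≐-sym (LinSet-map A α C)) (≐-sym (LinSet-map A β C)))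
    (≐-trans (≐-sym (LinSet-++ A (map (α *_) C) (map (β *_) C)))
    (LinSet-↭ A (signed-scale (a (ℕ.suc k)) (b (ℕ.suc k)) (posCoeffs a b k) (negCoeffs a b k))))))
    where
    α β : ℤ
    α = + a (ℕ.suc k)
    β = neg (b (ℕ.suc k))
    C : List ℤ
    C = signed (posCoeffs a b k) (negCoeffs a b k)
    IH : Γ a b A k ≐ LinSet A C
    IH = Γ≐LinSet a b A k

  LinSet-gather : ∀ A α β m {P N} R₁ R₂ → P ↭ replicate m α ++ R₁ → N ↭ replicate m β ++ R₂ →
    LinSet A (signed P N) ≐ diffPlus (+ α) (+ β) m A (LinSet A (signed R₁ R₂))
  LinSet-gather A α β m {P} {N} R₁ R₂ p q =
    ≐-trans (LinSet-↭ A rearranged)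
    (≐-trans (LinSet-++ A (replicate m (+ α)) _)
    (≐-trans (⊕-cong (LinSet-replicate A (+ α) m)
                     (≐-trans (LinSet-++ A (replicate m (neg β)) _) (⊕-cong (LinSet-replicate A (neg β) m) ≐-refl)))
    (≐-sym (diffPlus≐⊕ (+ α) (+ β) m A _))))
    where
    open PermutationReasoning
    rearranged : signed P N ↭ replicate m (+ α) ++ (replicate m (neg β) ++ signed R₁ R₂)
    rearranged = begin
      signed P N ↭⟨ Perm.++⁺ (Perm.map⁺ +_ p) (Perm.map⁺ neg q) ⟩
      map +_ (replicate m α ++ R₁) ++ map neg (replicate m β ++ R₂)
        ≡⟨ cong₂ _++_ (≡-trans (map-++ +_ (replicate m α) R₁) (cong (_++ _) (map-replicate +_ m α)))
                      (≡-trans (map-++ neg (replicate m β) R₂) (cong (_++ _) (map-replicate neg m β))) ⟩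
      (replicate m (+ α) ++ map +_ R₁) ++ (replicate m (neg β) ++ map neg R₂)
        ≡⟨ ++-assoc (replicate m (+ α)) (map +_ R₁) _ ⟩
      replicate m (+ α) ++ (map +_ R₁ ++ (replicate m (neg β) ++ map neg R₂))
        ↭⟨ Perm.++⁺ˡ (replicate m (+ α)) (Perm.shifts (map +_ R₁) (replicate m (neg β))) ⟩
      replicate m (+ α) ++ (replicate m (neg β) ++ (map +_ R₁ ++ map neg R₂)) ∎

open import Data.Nat using (ℕ; _≤_; _+_; _*_; _^_; _∸_)
open import Data.Integer using (+_; +≤+) renaming (_≤_ to _≤ℤ_)
open import Data.Product using (Σ; ∃; ∃₂; _×_)
open import Relation.Unary using (_≐_)

open import Data.Nat using (zero; suc; s≤s; z≤n; _<_)
open import Data.Nat.Properties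
open import Data.Nat.Tactic.RingSolver using (solve-∀)
open import Data.Product using (_,_; proj₁; proj₂)
open import Data.Sum using (inj₁; inj₂)
open import Data.Empty using (⊥-elim)
open import Function using (_∘′_)
open import Data.List using (List; []; _∷_; _++_; map; replicate; length; applyUpTo)
open import Data.List.Properties using (length-++; length-map; length-replicate; length-applyUpTo)
open import Data.List.Relation.Unary.All using (All; []; _∷_; zipWith) renaming (map to All-map; lookup to All-lookup)
open import Data.List.Relation.Unary.All.Properties using (++⁺; ++⁻ʳ; map⁺)
open import Data.List.Relation.Unary.Any using (here; there)
open import Data.List.Membership.Propositional using (_∈_)
open import Data.List.Membership.Propositional.Properties
  using (∈-++⁺ˡ; ∈-++⁺ʳ; ∈-++⁻; ∈-map⁺; ∈-map⁻; ∈-applyUpTo⁺)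
open import Data.List.Relation.Binary.Permutation.Propositional
  using (_↭_; ↭-refl; ↭-sym; ↭-trans; ↭-reflexive; prep)
open import Data.List.Relation.Binary.Permutation.Propositional.Properties
  using (↭-length; ∈-resp-↭; All-resp-↭; ++⁺ˡ; shifts; shift)
open import Relation.Nullary using (¬_; yes; no)
open import Relation.Unary.Properties using (≐-trans)
open import Relation.Binary.PropositionalEquality
open LinearSets

-- Each step k doubles the coefficient list and swaps signs in half of it, so for
-- k ≥ 1 there are exactly 2^(k-1) positive and 2^(k-1) negative coefficients.
module _ (a b : ℕ → ℕ) where

  step-length : ∀ k xs ys → length (map (a (suc k) *_) xs ++ map (b (suc k) *_) ys) ≡ length xs + length ys
  step-length k xs ys = trans (length-++ (map _ xs)) (cong₂ _+_ (length-map _ xs) (length-map _ ys))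

  coeffs-length : ∀ k → length (posCoeffs a b k) + length (negCoeffs a b k) ≡ 2 ^ k
  coeffs-length zero = refl
  coeffs-length (suc k) = begin
    length (map _ P ++ map _ N) + length (map _ N ++ map _ P)
      ≡⟨ cong₂ _+_ (step-length k P N) (step-length k N P) ⟩
    (length P + length N) + (length N + length P)
      ≡⟨ cong (_+_ (length P + length N)) (+-comm (length N) (length P)) ⟩
    (length P + length N) + (length P + length N)
      ≡⟨ cong₂ _+_ (coeffs-length k) (coeffs-length k) ⟩
    2 ^ k + 2 ^ k
      ≡⟨ cong (_+_ (2 ^ k)) (sym (+-identityʳ (2 ^ k))) ⟩
    2 ^ suc k ∎
    where
    open ≡-Reasoning
    P N : List ℕ
    P = posCoeffs a b k
    N = negCoeffs a b k

  posCoeffs-length : ∀ k → length (posCoeffs a b (suc k)) ≡ 2 ^ k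
  posCoeffs-length k = trans (step-length k (posCoeffs a b k) (negCoeffs a b k)) (coeffs-length k)

  negCoeffs-length : ∀ k → length (negCoeffs a b (suc k)) ≡ 2 ^ k
  negCoeffs-length k = trans (step-length k (negCoeffs a b k) (posCoeffs a b k))
    (trans (+-comm (length (negCoeffs a b k)) _) (coeffs-length k))

  coeffs-invariant : ∀ t (Q : ℕ → ℕ → Set) → Q 0 1 →
    (∀ k w → k < t → Q k w → Q (suc k) (a (suc k) * w) × Q (suc k) (b (suc k) * w)) →
    ∀ k → k ≤ t → All (Q k) (posCoeffs a b k) × All (Q k) (negCoeffs a b k)
  coeffs-invariant t Q q₀ step zero _ = q₀ ∷ [] , []
  coeffs-invariant t Q q₀ step (suc k) k<t with coeffs-invariant t Q q₀ step k (<⇒≤ k<t)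
  ... | qP , qN = ++⁺ (map⁺ (All-map byA qP)) (map⁺ (All-map byB qN)) ,
                  ++⁺ (map⁺ (All-map byA qN)) (map⁺ (All-map byB qP))
    where
    byA : ∀ {w} → Q k w → Q (suc k) (a (suc k) * w)
    byA = proj₁ ∘′ step k _ k<t
    byB : ∀ {w} → Q k w → Q (suc k) (b (suc k) * w)
    byB = proj₂ ∘′ step k _ k<t

-- All products of t factors taken from cs, one entry for each multiset of t
-- factors (repetitions of values are kept).
products : List ℕ → ℕ → List ℕ
products cs zero = 1 ∷ []
products [] (suc t) = []
products (c ∷ cs) (suc t) = products cs (suc t) ++ map (c *_) (products (c ∷ cs) t)

products-step : ∀ {c cs t w} → c ∈ cs → w ∈ products cs t → c * w ∈ products cs (suc t)
products-step {c} {c ∷ cs} (here refl) h = ∈-++⁺ʳ _ (∈-map⁺ (c *_) h)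
products-step {c} {d ∷ ds} {t} (there c∈ds) = extend t
  where
  swap-factors : ∀ d c w → d * (c * w) ≡ c * (d * w)
  swap-factors = solve-∀
  extend : ∀ t {w} → w ∈ products (d ∷ ds) t → c * w ∈ products (d ∷ ds) (suc t)
  extend zero h = ∈-++⁺ˡ (products-step c∈ds h)
  extend (suc t) h with ∈-++⁻ (products ds (suc t)) h
  ... | inj₁ h₁ = ∈-++⁺ˡ (products-step c∈ds h₁)
  ... | inj₂ h₂ with ∈-map⁻ (d *_) h₂
  ... | w , hw , refl = ∈-++⁺ʳ (products ds (suc (suc t)))
                          (subst (_∈ map (d *_) (products (d ∷ ds) (suc t))) (swap-factors d c w)
                            (∈-map⁺ (d *_) (extend t hw)))

-- If x² ≤ P and y² ≤ 8P then (x + y)² ≤ 16P; the proof weighs 2xy ≤ 3x² + y²/3.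
sum-square-bound : ∀ x y P → x * x ≤ P → y * y ≤ 8 * P → (x + y) * (x + y) ≤ 16 * P
sum-square-bound x y P x²≤P y²≤8P = *-cancelˡ-≤ 3 (begin
  3 * ((x + y) * (x + y))                                    ≡⟨ expand x y ⟩
  3 * (x * x) + (3 * (y * y) + 2 * ((3 * x) * y))            ≤⟨ +-monoʳ-≤ (3 * (x * x)) (+-monoʳ-≤ (3 * (y * y)) (am-gm (3 * x) y)) ⟩
  3 * (x * x) + (3 * (y * y) + ((3 * x) * (3 * x) + y * y))  ≡⟨ collect x y ⟩
  12 * (x * x) + 4 * (y * y)                                 ≤⟨ +-mono-≤ (*-monoʳ-≤ 12 x²≤P) (*-monoʳ-≤ 4 y²≤8P) ⟩
  12 * P + 4 * (8 * P)                                       ≤⟨ m≤m+n (12 * P + 4 * (8 * P)) (4 * P) ⟩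
  12 * P + 4 * (8 * P) + 4 * P                               ≡⟨ regroup P ⟩
  3 * (16 * P)                                               ∎)
  where
  open ≤-Reasoning
  am-gm : ∀ p q → 2 * (p * q) ≤ p * p + q * q
  am-gm p q with ≤-total p q
  ... | inj₁ p≤q with m≤n⇒∃[o]m+o≡n p≤q
  ...   | d , refl = ≤-trans (m≤m+n _ (d * d)) (≤-reflexive (square p d))
    where
    square : ∀ p d → 2 * (p * (p + d)) + d * d ≡ p * p + (p + d) * (p + d)
    square = solve-∀
  am-gm p q | inj₂ q≤p with m≤n⇒∃[o]m+o≡n q≤p
  ...   | d , refl = ≤-trans (m≤m+n _ (d * d)) (≤-reflexive (square q d))
    where
    square : ∀ q d → 2 * ((q + d) * q) + d * d ≡ (q + d) * (q + d) + q * q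
    square = solve-∀
  expand : ∀ x y → 3 * ((x + y) * (x + y)) ≡ 3 * (x * x) + (3 * (y * y) + 2 * ((3 * x) * y))
  expand = solve-∀
  collect : ∀ x y → 3 * (x * x) + (3 * (y * y) + ((3 * x) * (3 * x) + y * y)) ≡ 12 * (x * x) + 4 * (y * y)
  collect = solve-∀
  regroup : ∀ P → 12 * P + 4 * (8 * P) + 4 * P ≡ 3 * (16 * P)
  regroup = solve-∀

products-length : ∀ cs t → length (products cs t) * length (products cs t) ≤ 2 ^ (t + 4 * length cs)
products-length cs zero = m^n>0 2 (4 * length cs)
products-length [] (suc t) = z≤n
products-length (c ∷ cs) (suc t) =
  subst (λ z → z * z ≤ 2 ^ (suc t + 4 * suc n)) (sym step-count)
    (subst ((x + y) * (x + y) ≤_) (sym (exponent-shift 4 (more-factors t n)))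
      (sum-square-bound x y _ (products-length cs (suc t))
        (subst (y * y ≤_) (exponent-shift 3 (one-less t n)) (products-length (c ∷ cs) t))))
  where
  n x y : ℕ
  n = length cs
  x = length (products cs (suc t))
  y = length (products (c ∷ cs) t)
  step-count : length (products (c ∷ cs) (suc t)) ≡ length (products cs (suc t)) + length (products (c ∷ cs) t)
  step-count = trans (length-++ (products cs (suc t))) (cong (_+_ x) (length-map (c *_) (products (c ∷ cs) t)))
  exponent-shift : ∀ j {e e′} → e ≡ j + e′ → 2 ^ e ≡ 2 ^ j * 2 ^ e′
  exponent-shift j {e′ = e′} refl = ^-distribˡ-+-* 2 j e′
  one-less : ∀ t n → t + 4 * suc n ≡ 3 + (suc t + 4 * n)
  one-less = solve-∀
  more-factors : ∀ t n → suc t + 4 * suc n ≡ 4 + (suc t + 4 * n)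
  more-factors = solve-∀

separate : ∀ (y : ℕ) xs → ∃₂ λ k rest → (xs ↭ replicate k y ++ rest) × All (λ r → ¬ y ≡ r) rest
separate y [] = 0 , [] , ↭-refl , []
separate y (x ∷ xs) with separate y xs | y ≟ x
... | k , rest , p , y∉rest | yes refl = suc k , rest , prep y p , y∉rest
... | k , rest , p , y∉rest | no y≢x =
  k , x ∷ rest , ↭-trans (prep x p) (↭-sym (shift x (replicate k y) rest)) , y≢x ∷ y∉rest

replicate-+ : ∀ m d (y : ℕ) rest → replicate (m + d) y ++ rest ≡ replicate m y ++ (replicate d y ++ rest)
replicate-+ zero d y rest = refl
replicate-+ (suc m) d y rest = cong (y ∷_) (replicate-+ m d y rest)

pigeonhole : ∀ m ys xs → All (_∈ ys) xs → m * length ys < length xs →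
  ∃₂ λ y rest → xs ↭ replicate (suc m) y ++ rest
pigeonhole m [] [] [] ()
pigeonhole m [] (x ∷ xs) (() ∷ _) _
pigeonhole m (y ∷ ys) xs xs⊆ys m|ys|<|xs| with separate y xs
... | k , rest , p , y∉rest with suc m ≤? k
...   | yes m<k with d , refl ← m≤n⇒∃[o]m+o≡n m<k =
  y , replicate d y ++ rest , ↭-trans p (↭-reflexive (replicate-+ (suc m) d y rest))
...   | no m≮k with pigeonhole m ys rest rest⊆ys rest-large
  where
  rest⊆ys : All (_∈ ys) rest
  rest⊆ys = zipWith not-y (y∉rest , ++⁻ʳ (replicate k y) (All-resp-↭ p xs⊆ys))
    where
    not-y : ∀ {r} → (¬ y ≡ r) × r ∈ (y ∷ ys) → r ∈ ys
    not-y (y≢r , here r≡y) = ⊥-elim (y≢r (sym r≡y))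
    not-y (_ , there r∈ys) = r∈ys
  rest-large : m * length ys < length rest
  rest-large = +-cancelˡ-< m (m * length ys) (length rest) (begin-strict
    m + m * length ys        ≡⟨ sym (*-suc m (length ys)) ⟩
    m * suc (length ys)      <⟨ m|ys|<|xs| ⟩
    length xs                ≡⟨ trans (↭-length p) (length-++ (replicate k y)) ⟩
    length (replicate k y) + length rest ≡⟨ cong (_+ length rest) (length-replicate k) ⟩
    k + length rest          ≤⟨ +-monoˡ-≤ (length rest) (≤-pred (≰⇒> m≮k)) ⟩
    m + length rest          ∎)
    where open ≤-Reasoning
... | z , rest′ , q = z , replicate k y ++ rest′ ,
  ↭-trans p (↭-trans (++⁺ˡ (replicate k y) q) (shifts (replicate k y) (replicate (suc m) z)))

square-reflects-≤ : ∀ p q → p * p ≤ q * q → p ≤ q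
square-reflects-≤ p q p²≤q² with ≤-<-connex p q
... | inj₁ p≤q = p≤q
... | inj₂ q<p = ⊥-elim (<⇒≱ (*-mono-< q<p q<p) p²≤q²)

drop-one-copy : ∀ m g {N} → 0 < N → suc m * g ≤ N → m * g < N
drop-one-copy m zero {N} 0<N _ = subst (_< N) (sym (*-zeroʳ m)) 0<N
drop-one-copy m (suc g) _ = <-≤-trans (m<n+m (m * suc g) (s≤s z≤n))

-- The numerical heart of the hypothesis t ≥ 2 log₂ m + 4L + 2: writing t + 1 for t,
-- if m² ≤ 2^(t+1-(4L+2)) and f² ≤ 2^(t+1+4L), then (m f)² ≤ 2^(2t); hence
-- (m - 1) f < 2^t, which is what the pigeonhole principle needs.
room-for-repetition : ∀ L m f t → 4 * L + 2 ≤ suc t → suc m * suc m ≤ 2 ^ (suc t ∸ (4 * L + 2)) →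
  f * f ≤ 2 ^ (suc t + 4 * L) → m * f < 2 ^ t
room-for-repetition L m f t t-large m-small f-small
  with d , refl ← m≤n⇒∃[o]m+o≡n (≤-pred (subst (_≤ suc t) (+-suc (4 * L) 1) t-large)) =
  drop-one-copy m f (m^n>0 2 t) (square-reflects-≤ (suc m * f) (2 ^ t) (begin
    (suc m * f) * (suc m * f)                 ≡⟨ interchange (suc m) f ⟩
    (suc m * suc m) * (f * f)                 ≤⟨ *-mono-≤ m²≤2^d f-small ⟩
    2 ^ d * 2 ^ (suc t + 4 * L)               ≡⟨ sym (^-distribˡ-+-* 2 d (suc t + 4 * L)) ⟩
    2 ^ (d + (suc t + 4 * L))                 ≡⟨ cong (2 ^_) (exponents L d) ⟩
    2 ^ (t + t)                               ≡⟨ ^-distribˡ-+-* 2 t t ⟩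
    2 ^ t * 2 ^ t                             ∎))
  where
  open ≤-Reasoning
  interchange : ∀ p q → (p * q) * (p * q) ≡ (p * p) * (q * q)
  interchange = solve-∀
  exponents : ∀ L d → d + (suc (4 * L + 1 + d) + 4 * L) ≡ (4 * L + 1 + d) + (4 * L + 1 + d)
  exponents = solve-∀
  unfold-t : ∀ L d → suc (4 * L + 1 + d) ≡ 4 * L + 2 + d
  unfold-t = solve-∀
  m²≤2^d : suc m * suc m ≤ 2 ^ d
  m²≤2^d = subst (λ e → suc m * suc m ≤ 2 ^ e)
                 (trans (cong (_∸ (4 * L + 2)) (unfold-t L d)) (m+n∸m≡n (4 * L + 2) d)) m-small

factors : ℕ → List ℕ
factors L = applyUpTo suc L

factor-∈ : ∀ {L c} → 1 ≤ c → c ≤ L → c ∈ factors L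
factor-∈ {c = suc i} _ c≤L = ∈-applyUpTo⁺ suc c≤L

Admissible : ℕ → ℕ → ℕ → Set
Admissible L k w = (1 ≤ w × w ≤ L ^ k) × w ∈ products (factors L) k

admissible-step : ∀ L k c w → 1 ≤ c → c ≤ L → Admissible L k w → Admissible L (suc k) (c * w)
admissible-step L k c w 1≤c c≤L ((1≤w , w≤L^k) , w∈) =
  (*-mono-≤ 1≤c 1≤w , *-mono-≤ c≤L w≤L^k) , products-step (factor-∈ 1≤c c≤L) w∈

coeffs-admissible : ∀ L t (a b : ℕ → ℕ) →
  (∀ i → 1 ≤ i → i ≤ t → (1 ≤ a i × a i ≤ L) × (1 ≤ b i × b i ≤ L)) →
  All (Admissible L t) (posCoeffs a b t) × All (Admissible L t) (negCoeffs a b t)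
coeffs-admissible L t a b factor-bounds =
  coeffs-invariant a b t (Admissible L) ((≤-refl , ≤-refl) , here refl) step t ≤-refl
  where
  step : ∀ k w → k < t → Admissible L k w →
         Admissible L (suc k) (a (suc k) * w) × Admissible L (suc k) (b (suc k) * w)
  step k w k<t w-admissible with factor-bounds (suc k) (s≤s z≤n) k<t
  ... | (1≤a , a≤L) , (1≤b , b≤L) =
    admissible-step L k _ w 1≤a a≤L w-admissible , admissible-step L k _ w 1≤b b≤L w-admissible

few-products : ∀ L m t → 4 * L + 2 ≤ suc t → suc m * suc m ≤ 2 ^ (suc t ∸ (4 * L + 2)) →
  m * length (products (factors L) (suc t)) < 2 ^ t
few-products L m t t-large m-small = room-for-repetition L m (length W) t t-large m-small
  (subst (λ n → length W * length W ≤ 2 ^ (suc t + 4 * n)) (length-applyUpTo suc L) (products-length (factors L) (suc t)))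
  where
  W : List ℕ
  W = products (factors L) (suc t)

frequent-admissible : ∀ L m t xs → 4 * L + 2 ≤ suc t → suc m * suc m ≤ 2 ^ (suc t ∸ (4 * L + 2)) →
  length xs ≡ 2 ^ t → All (Admissible L (suc t)) xs →
  ∃₂ λ α rest → (1 ≤ α × α ≤ L ^ suc t) × xs ↭ replicate (suc m) α ++ rest
frequent-admissible L m t xs t-large m-small |xs|≡2^t admissible
  with pigeonhole m _ xs (All-map proj₂ admissible)
         (subst (_ <_) (sym |xs|≡2^t) (few-products L m t t-large m-small))
... | α , rest , p = α , rest , proj₁ (All-lookup admissible (∈-resp-↭ (↭-sym p) (here refl))) , p

lemma4p3 : (t L : ℕ) → 1 ≤ t → 2 ≤ L →
    (a b : ℕ → ℕ) →
    (∀ i → 1 ≤ i → i ≤ t → (1 ≤ a i × a i ≤ L) × (1 ≤ b i × b i ≤ L)) →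
    (A : ZSet) → (∀ x → A x → + 0 ≤ℤ x) →
    (m : ℕ) → 1 ≤ m →
    4 * L + 2 ≤ t → m * m ≤ 2 ^ (t ∸ (4 * L + 2)) →
    ∃₂ λ (α β : ℕ) → (1 ≤ α × α ≤ L ^ t) × (1 ≤ β × β ≤ L ^ t) ×
      Σ ZSet (λ B → Γ a b A t ≐ diffPlus (+ α) (+ β) m A B)
-- The cases t = 0 and m = 0 are excluded by the hypotheses 1 ≤ t and 1 ≤ m.
lemma4p3 (suc t) L _ _ a b factor-bounds A _ (suc m) _ t-large m-small
  with frequent-admissible L m t _ t-large m-small (posCoeffs-length a b t) (proj₁ admissible)
     | frequent-admissible L m t _ t-large m-small (negCoeffs-length a b t) (proj₂ admissible)
  where
  admissible : All (Admissible L (suc t)) (posCoeffs a b (suc t)) × All (Admissible L (suc t)) (negCoeffs a b (suc t))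
  admissible = coeffs-admissible L (suc t) a b factor-bounds
... | α , R₁ , α-bounds , p | β , R₂ , β-bounds , q =
  α , β , α-bounds , β-bounds , LinSet A (signed R₁ R₂) ,
  ≐-trans (Γ≐LinSet a b A (suc t)) (LinSet-gather A α β (suc m) R₁ R₂ p q)
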